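{- Let $T$ be an $\omega$-continuous strong monad, let $(\rho^{\mathsf v},\rho^{\mathsf c},\chi)$ be a separated abstract higher-order GSOS law with $\omega$-continuous $\chi$, and let $\xi$ and $\hat\zeta$ be the induced big-step data (as defined in the context). Then $\hat\zeta=\mu f.\,[\eta^T,\ f^\sharp\circ T\nabla^\sharp\circ(\rho^{\mathsf{cv}}_{\mu\Sigma,\mu\Sigma})^\sharp\circ\chi\circ\Sigma_{\mathsf c}(T\langle\iota^{\mathsf v},\gamma^{\mathsf v}\rangle\circ f,\mathrm{id})]\circ\iota^{ -1}$, the least fixpoint being taken in $\mathcal C(\mu\Sigma,TS_{\mathsf v})$.
   Context: Conventions: $\mathcal C$ is a distributive category; $\mathrm{inl},\mathrm{inr}$, $[f,g]$, $\langle f,g\rangle$, $\mathrm{fst},\mathrm{snd}$, $\nabla=[\mathrm{id},\mathrm{id}]$ as usual. Syntax: functors $\Sigma_{\mathsf v}\colon\mathcal C\to\mathcal C$, $\Sigma_{\mathsf c}\colon\mathcal C\times\mathcal C\to\mathcal C$, $\Sigma X=\Sigma_{\mathsf v}X+\Sigma_{\mathsf c}(X,X)$; free $\Sigma$-algebras exist; $(\Sigma^\star,\eta^\Sigma,\mu^\Sigma)$ is the free monad with algebra structures $\iota_X$; $\iota^{\mathsf v}=\iota\circ\mathrm{inl}$. $\mu\Sigma=\Sigma^\star0$ with invertible $\iota\colon\Sigma\mu\Sigma\to\mu\Sigma$; $S_{\mathsf v}=\Sigma_{\mathsf v}\mu\Sigma$, $S_{\mathsf c}=\Sigma_{\mathsf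 c}(\mu\Sigma,\mu\Sigma)$, $\iota^{ -1}\colon\mu\Sigma\to S_{\mathsf v}+S_{\mathsf c}$. For every $X$, $\nabla^\sharp=\mu^\Sigma_X\circ\Sigma^\star\nabla\colon\Sigma^\star(\Sigma^\star X+\Sigma^\star X)\to\Sigma^\star X$; $\mu^\Sigma_0\colon\Sigma^\star\mu\Sigma\to\mu\Sigma$. Behaviour: $T$ a strong monad (unit $\eta^T$, multiplication $m^T$, strength $\tau$), $f^\sharp=m^T\circ Tf$; $D\colon\mathcal C^{op}\times\mathcal C\to\mathcal C$; $B(X,Y)=TD(X,Y)+TY$. Separated law $(\rho^{\mathsf v},\rho^{\mathsf c},\chi)$: $\rho^{\mathsf v}_X\colon\Sigma_{\mathsf v}X\to D(X,\Sigma^\star X)$ dinatural; $\rho^{\mathsf c}_{X,Y}\colon\Sigma_{\mathsf c}(X\times B(X,Y),X)\to T\Sigma^\star(X+Y)$ dinatural in $X$, natural in $Y$; $\chi_{X,Y}\colon\Sigma_{\mathsf c}(TX,Y)\to T\Sigma_{\mathsf c}(X,Y)$ natural, a distributive law of $T$ over each $\Sigma_{\mathsf c}(-,Y)$. $\rho^{\mathsf{cv}}=\rho^{\mathsf c}\circ\Sigma_{\mathsf c}(\mathrm{id}\times\mathrm{inl},\mathrm{id})$. $\gamma^{\mathsf v}=\eta^T\circ D(\mathrm{id},\mu^\Sigma_0)\circ\rho^{\mathsf v}_{\mu\Sigma}\colon S_{\mathsf v}\to TD(\mu\Sigma,\mu\Sigma)$. $\omega$-continuity: $T$ is $\omega$-continuous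 if each $\mathcal C(X,TY)$ is an $\omega$-cpo under $\sqsubseteq$ with least element $\bot$, Kleisli composition is $\omega$-continuous in each argument, strength and copairing preserve joins of chains, $\tau\circ(\mathrm{id}\times\bot)=\bot$ and $f^\sharp\circ\bot=\bot$. $\chi$ is $\omega$-continuous if every $f\mapsto\chi\circ\Sigma_{\mathsf c}(f,\mathrm{id})$ is $\omega$-continuous. $\mu f.F(f)$ is the least fixpoint. Big-step data: $\xi_X=T\nabla^\sharp\circ\rho^{\mathsf{cv}}_{\Sigma^\star X,\Sigma^\star X}\circ\Sigma_{\mathsf c}(\langle\iota^{\mathsf v},\eta^T\circ D(\mathrm{id},\mu^\Sigma_X)\circ\rho^{\mathsf v}_{\Sigma^\star X}\rangle,\mathrm{id})\circ\Sigma_{\mathsf c}(\Sigma_{\mathsf v}\eta^\Sigma_X,\eta^\Sigma_X)\colon\Sigma_{\mathsf c}(\Sigma_{\mathsf v}X,X)\to T\Sigma^\star X$; $\hat\zeta=\mu f.\,[\eta^T,f^\sharp\circ T\mu^\Sigma_0\circ\xi_{\mu\Sigma}^\sharp\circ\chi\circ\Sigma_{\mathsf c}(f,\mathrm{id})]\circ\iota^{ -1}\colon\mu\Sigma\to TS_{\mathsf v}$. -}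

module Defs where

open import Level using (Level; _⊔_) renaming (suc to lsuc)
open import Data.Nat using (ℕ; suc)
open import Data.Product using (Σ; _×_; _,_)
open import Relation.Binary.PropositionalEquality using (_≡_)

record Category (o h : Level) : Set (lsuc (o ⊔ h)) where
  infixr 9 _∘_
  field
    Obj : Set o
    Hom : Obj → Obj → Set h
    id  : ∀ {A} → Hom A A
    _∘_ : ∀ {A B C} → Hom B C → Hom A B → Hom A C
    identityˡ : ∀ {A B} {f : Hom A B} → id ∘ f ≡ f
    identityʳ : ∀ {A B} {f : Hom A B} → f ∘ id ≡ f
    assoc : ∀ {A B C D} {f : Hom A B} {g : Hom B C} {k : Hom C D} →
            (k ∘ g) ∘ f ≡ k ∘ (g ∘ f)

-- Distributive category: finite products, finite coproducts, and the
-- canonical maps  X×Y + X×Z → X×(Y+Z)  and  0 → X×0  are invertible.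
record Distributive {o h} (C : Category o h) : Set (o ⊔ h) where
  open Category C
  infixr 7 _⊗_
  infixr 6 _⊕_
  field
    𝟙 : Obj
    ! : ∀ {A} → Hom A 𝟙
    !-unique : ∀ {A} (f : Hom A 𝟙) → f ≡ !
    _⊗_ : Obj → Obj → Obj
    fst : ∀ {A B} → Hom (A ⊗ B) A
    snd : ∀ {A B} → Hom (A ⊗ B) B
    ⟨_,_⟩ : ∀ {X A B} → Hom X A → Hom X B → Hom X (A ⊗ B)
    fst-⟨⟩ : ∀ {X A B} {f : Hom X A} {g : Hom X B} → fst ∘ ⟨ f , g ⟩ ≡ f
    snd-⟨⟩ : ∀ {X A B} {f : Hom X A} {g : Hom X B} → snd ∘ ⟨ f , g ⟩ ≡ g
    ⟨⟩-unique : ∀ {X A B} {f : Hom X A} {g : Hom X B} {k : Hom X (A ⊗ B)} →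
                fst ∘ k ≡ f → snd ∘ k ≡ g → k ≡ ⟨ f , g ⟩
    𝟘 : Obj
    ¡ : ∀ {A} → Hom 𝟘 A
    ¡-unique : ∀ {A} (f : Hom 𝟘 A) → f ≡ ¡
    _⊕_ : Obj → Obj → Obj
    inl : ∀ {A B} → Hom A (A ⊕ B)
    inr : ∀ {A B} → Hom B (A ⊕ B)
    [_,_] : ∀ {A B X} → Hom A X → Hom B X → Hom (A ⊕ B) X
    []-inl : ∀ {A B X} {f : Hom A X} {g : Hom B X} → [ f , g ] ∘ inl ≡ f
    []-inr : ∀ {A B X} {f : Hom A X} {g : Hom B X} → [ f , g ] ∘ inr ≡ g
    []-unique : ∀ {A B X} {f : Hom A X} {g : Hom B X} {k : Hom (A ⊕ B) X} →
                k ∘ inl ≡ f → k ∘ inr ≡ g → k ≡ [ f , g ]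
    distr⁻¹ : ∀ {X Y Z} → Hom (X ⊗ (Y ⊕ Z)) ((X ⊗ Y) ⊕ (X ⊗ Z))
    distr-inv₁ : ∀ {X Y Z} →
      distr⁻¹ ∘ [ ⟨ fst , inl ∘ snd ⟩ , ⟨ fst , inr ∘ snd ⟩ ] ≡ id {(X ⊗ Y) ⊕ (X ⊗ Z)}
    distr-inv₂ : ∀ {X Y Z} →
      [ ⟨ fst , inl ∘ snd ⟩ , ⟨ fst , inr ∘ snd ⟩ ] ∘ distr⁻¹ ≡ id {X ⊗ (Y ⊕ Z)}
    annih-inv : ∀ {X} → ¡ ∘ snd ≡ id {X ⊗ 𝟘}

module DistOps {o h} {C : Category o h} (DC : Distributive C) where
  open Category C
  open Distributive DC

  _⊗₁_ : ∀ {A A' B B'} → Hom A A' → Hom B B' → Hom (A ⊗ B) (A' ⊗ B')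
  f ⊗₁ g = ⟨ f ∘ fst , g ∘ snd ⟩

  _⊕₁_ : ∀ {A A' B B'} → Hom A A' → Hom B B' → Hom (A ⊕ B) (A' ⊕ B')
  f ⊕₁ g = [ inl ∘ f , inr ∘ g ]

  ∇ : ∀ {A} → Hom (A ⊕ A) A
  ∇ = [ id , id ]

  assocʳ : ∀ {A B E} → Hom ((A ⊗ B) ⊗ E) (A ⊗ (B ⊗ E))
  assocʳ = ⟨ fst ∘ fst , ⟨ snd ∘ fst , snd ⟩ ⟩

record Functor {o h} (C : Category o h) : Set (o ⊔ h) where
  open Category C
  field
    F₀ : Obj → Obj
    F₁ : ∀ {A B} → Hom A B → Hom (F₀ A) (F₀ B)
    F-id : ∀ {A} → F₁ (id {A}) ≡ id
    F-∘ : ∀ {A B E} {f : Hom A B} {g : Hom B E} → F₁ (g ∘ f) ≡ F₁ g ∘ F₁ f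

record Bifunctor {o h} (C : Category o h) : Set (o ⊔ h) where
  open Category C
  field
    F₀ : Obj → Obj → Obj
    F₁ : ∀ {A A' B B'} → Hom A A' → Hom B B' → Hom (F₀ A B) (F₀ A' B')
    F-id : ∀ {A B} → F₁ (id {A}) (id {B}) ≡ id
    F-∘ : ∀ {A A' A'' B B' B''} {f : Hom A A'} {f' : Hom A' A''}
            {g : Hom B B'} {g' : Hom B' B''} →
          F₁ (f' ∘ f) (g' ∘ g) ≡ F₁ f' g' ∘ F₁ f g

record MixedBifunctor {o h} (C : Category o h) : Set (o ⊔ h) where
  open Category C
  field
    F₀ : Obj → Obj → Obj
    F₁ : ∀ {A A' B B'} → Hom A' A → Hom B B' → Hom (F₀ A B) (F₀ A' B')
    F-id : ∀ {A B} → F₁ (id {A}) (id {B}) ≡ id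
    F-∘ : ∀ {A A' A'' B B' B''} {f : Hom A' A} {f' : Hom A'' A'}
            {g : Hom B B'} {g' : Hom B' B''} →
          F₁ (f ∘ f') (g' ∘ g) ≡ F₁ f' g' ∘ F₁ f g

record Signature {o h} (C : Category o h) : Set (o ⊔ h) where
  field
    Σv : Functor C
    Σc : Bifunctor C

module SigOps {o h} {C : Category o h} (DC : Distributive C) (S : Signature C) where
  open Category C
  open Distributive DC
  open DistOps DC
  open Signature S
  module V = Functor Σv
  module K = Bifunctor Σc

  Σ₀ : Obj → Obj
  Σ₀ X = V.F₀ X ⊕ K.F₀ X X

  Σ₁ : ∀ {A B} → Hom A B → Hom (Σ₀ A) (Σ₀ B)
  Σ₁ f = V.F₁ f ⊕₁ K.F₁ f f

-- The structure map of the initial algebra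
-- μΣ = Σ⋆0 is invertible (Lambek); its (unique) inverse is recorded.
record FreeAlgebras {o h} {C : Category o h} (DC : Distributive C) (S : Signature C)
       : Set (o ⊔ h) where
  open Category C
  open Distributive DC
  open SigOps DC S
  field
    Free : Obj → Obj
    ι    : ∀ {X} → Hom (Σ₀ (Free X)) (Free X)
    η    : ∀ {X} → Hom X (Free X)
    fold : ∀ {X A} → Hom (Σ₀ A) A → Hom X A → Hom (Free X) A
    fold-ι : ∀ {X A} {a : Hom (Σ₀ A) A} {f : Hom X A} →
             fold a f ∘ ι ≡ a ∘ Σ₁ (fold a f)
    fold-η : ∀ {X A} {a : Hom (Σ₀ A) A} {f : Hom X A} → fold a f ∘ η ≡ f
    fold-unique : ∀ {X A} {a : Hom (Σ₀ A) A} {f : Hom X A} {k : Hom (Free X) A} →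
                  k ∘ ι ≡ a ∘ Σ₁ k → k ∘ η ≡ f → k ≡ fold a f
    ι⁻¹ : Hom (Free 𝟘) (Σ₀ (Free 𝟘))
    ι⁻¹-inv₁ : ι ∘ ι⁻¹ ≡ id
    ι⁻¹-inv₂ : ι⁻¹ ∘ ι ≡ id

module FreeOps {o h} {C : Category o h} {DC : Distributive C} {S : Signature C}
       (FA : FreeAlgebras DC S) where
  open Category C
  open Distributive DC
  open DistOps DC
  open SigOps DC S
  open FreeAlgebras FA

  Σ⋆₁ : ∀ {A B} → Hom A B → Hom (Free A) (Free B)
  Σ⋆₁ f = fold ι (η ∘ f)

  μΣ : ∀ {X} → Hom (Free (Free X)) (Free X)
  μΣ = fold ι id

  ∇♯ : ∀ {X} → Hom (Free (Free X ⊕ Free X)) (Free X)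
  ∇♯ = μΣ ∘ Σ⋆₁ ∇

  ιv : ∀ {X} → Hom (V.F₀ (Free X)) (Free X)
  ιv = ι ∘ inl

  Init : Obj
  Init = Free 𝟘

  Sv : Obj
  Sv = V.F₀ Init

  Sc : Obj
  Sc = K.F₀ Init Init

  μ₀ : Hom (Free Init) Init
  μ₀ = μΣ

record StrongMonad {o h} {C : Category o h} (DC : Distributive C) : Set (o ⊔ h) where
  open Category C
  open Distributive DC
  open DistOps DC
  field
    T : Functor C
  open Functor T renaming (F₀ to T₀; F₁ to T₁)
  field
    ηT : ∀ {X} → Hom X (T₀ X)
    mT : ∀ {X} → Hom (T₀ (T₀ X)) (T₀ X)
    τ  : ∀ {X Y} → Hom (X ⊗ T₀ Y) (T₀ (X ⊗ Y))
    ηT-nat : ∀ {X Y} {f : Hom X Y} → T₁ f ∘ ηT ≡ ηT ∘ f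
    mT-nat : ∀ {X Y} {f : Hom X Y} → T₁ f ∘ mT ≡ mT ∘ T₁ (T₁ f)
    unitˡ : ∀ {X} → mT ∘ ηT ≡ id {T₀ X}
    unitʳ : ∀ {X} → mT ∘ T₁ ηT ≡ id {T₀ X}
    mT-assoc : ∀ {X} → mT ∘ mT ≡ mT ∘ T₁ (mT {X})
    τ-nat : ∀ {X X' Y Y'} {f : Hom X X'} {g : Hom Y Y'} →
            T₁ (f ⊗₁ g) ∘ τ ≡ τ ∘ (f ⊗₁ T₁ g)
    τ-unit : ∀ {X} → T₁ snd ∘ τ {𝟙} {X} ≡ snd
    τ-assoc : ∀ {X Y Z} →
              T₁ assocʳ ∘ τ {X ⊗ Y} {Z} ≡ τ ∘ (id ⊗₁ τ) ∘ assocʳ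
    τ-ηT : ∀ {X Y} → τ ∘ (id ⊗₁ ηT) ≡ ηT {X ⊗ Y}
    τ-mT : ∀ {X Y} → τ ∘ (id ⊗₁ mT) ≡ mT ∘ T₁ τ ∘ τ {X} {T₀ Y}

module MonadOps {o h} {C : Category o h} {DC : Distributive C} (M : StrongMonad DC) where
  open Category C
  open StrongMonad M
  open Functor T public renaming (F₀ to T₀; F₁ to T₁)

  _♯ : ∀ {X Y} → Hom X (T₀ Y) → Hom (T₀ X) (T₀ Y)
  f ♯ = mT ∘ T₁ f

record KleisliCPO {o h} {C : Category o h} {DC : Distributive C}
       (M : StrongMonad DC) (r : Level) : Set (o ⊔ h ⊔ lsuc r) where
  open Category C
  open MonadOps M
  field
    _⊑_ : ∀ {X Y} → Hom X (T₀ Y) → Hom X (T₀ Y) → Set r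
    ⊑-refl : ∀ {X Y} {f : Hom X (T₀ Y)} → f ⊑ f
    ⊑-trans : ∀ {X Y} {f g k : Hom X (T₀ Y)} → f ⊑ g → g ⊑ k → f ⊑ k
    ⊑-antisym : ∀ {X Y} {f g : Hom X (T₀ Y)} → f ⊑ g → g ⊑ f → f ≡ g
    ⊥ : ∀ {X Y} → Hom X (T₀ Y)
    ⊥-least : ∀ {X Y} {f : Hom X (T₀ Y)} → ⊥ ⊑ f
    ⨆ : ∀ {X Y} (c : ℕ → Hom X (T₀ Y)) → (∀ n → c n ⊑ c (suc n)) → Hom X (T₀ Y)
    ⨆-upper : ∀ {X Y} (c : ℕ → Hom X (T₀ Y)) (ch : ∀ n → c n ⊑ c (suc n)) →
              ∀ n → c n ⊑ ⨆ c ch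
    ⨆-least : ∀ {X Y} (c : ℕ → Hom X (T₀ Y)) (ch : ∀ n → c n ⊑ c (suc n)) →
              ∀ {f} → (∀ n → c n ⊑ f) → ⨆ c ch ⊑ f

module CPOOps {o h r} {C : Category o h} {DC : Distributive C} {M : StrongMonad DC}
       (P : KleisliCPO M r) where
  open Category C
  open MonadOps M
  open KleisliCPO P

  Chain : ∀ {X Y} → (ℕ → Hom X (T₀ Y)) → Set r
  Chain c = ∀ n → c n ⊑ c (suc n)

  record Continuous {X Y X' Y'} (F : Hom X (T₀ Y) → Hom X' (T₀ Y'))
         : Set (h ⊔ r) where
    field
      mono : ∀ {f g} → f ⊑ g → F f ⊑ F g
      sup  : ∀ (c : ℕ → Hom X (T₀ Y)) (ch : Chain c) →
             F (⨆ c ch) ≡ ⨆ (λ n → F (c n)) (λ n → mono (ch n))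

  IsLeastFixpoint : ∀ {X Y} → (Hom X (T₀ Y) → Hom X (T₀ Y)) → Hom X (T₀ Y) → Set (h ⊔ r)
  IsLeastFixpoint F z = (F z ≡ z) × (∀ w → F w ≡ w → z ⊑ w)

record OmegaContinuous {o h r} {C : Category o h} {DC : Distributive C}
       {M : StrongMonad DC} (P : KleisliCPO M r) : Set (o ⊔ h ⊔ r) where
  open Category C
  open Distributive DC
  open DistOps DC
  open StrongMonad M using (τ)
  open MonadOps M
  open KleisliCPO P
  open CPOOps P
  field
    kleisli-contʳ : ∀ {X Y Z} (g : Hom Y (T₀ Z)) →
                    Continuous (λ (f : Hom X (T₀ Y)) → g ♯ ∘ f)
    kleisli-contˡ : ∀ {X Y Z} (f : Hom X (T₀ Y)) →
                    Continuous (λ (g : Hom Y (T₀ Z)) → g ♯ ∘ f)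
    strength-cont : ∀ {W X Y} →
                    Continuous (λ (f : Hom X (T₀ Y)) → τ ∘ (id {W} ⊗₁ f))
    copair-mono : ∀ {A B Y} {f f' : Hom A (T₀ Y)} {g g' : Hom B (T₀ Y)} →
                  f ⊑ f' → g ⊑ g' → [ f , g ] ⊑ [ f' , g' ]
    copair-sup : ∀ {A B Y} (c : ℕ → Hom A (T₀ Y)) (ch : Chain c)
                   (d : ℕ → Hom B (T₀ Y)) (dh : Chain d) →
                 [ ⨆ c ch , ⨆ d dh ] ≡
                 ⨆ (λ n → [ c n , d n ]) (λ n → copair-mono (ch n) (dh n))
    τ-⊥ : ∀ {W X Y} → τ ∘ (id {W} ⊗₁ ⊥ {X} {Y}) ≡ ⊥
    ♯-⊥ : ∀ {X Y Z} {f : Hom Y (T₀ Z)} → f ♯ ∘ ⊥ {X} ≡ ⊥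

module BehOps {o h} {C : Category o h} {DC : Distributive C} (M : StrongMonad DC)
       (D : MixedBifunctor C) where
  open Category C
  open Distributive DC
  open DistOps DC
  open MonadOps M
  module Dm = MixedBifunctor D

  B₀ : Obj → Obj → Obj
  B₀ X Y = T₀ (Dm.F₀ X Y) ⊕ T₀ Y

  B₁ : ∀ {A A' B B'} → Hom A' A → Hom B B' → Hom (B₀ A B) (B₀ A' B')
  B₁ f g = T₁ (Dm.F₁ f g) ⊕₁ T₁ g

record SeparatedLaw {o h} {C : Category o h} {DC : Distributive C} {S : Signature C}
       (FA : FreeAlgebras DC S) (M : StrongMonad DC) (D : MixedBifunctor C)
       : Set (o ⊔ h) where
  open Category C
  open Distributive DC
  open DistOps DC
  open SigOps DC S
  open FreeAlgebras FA
  open FreeOps FA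
  open StrongMonad M using (ηT; mT)
  open MonadOps M
  open BehOps M D
  field
    ρv : ∀ X → Hom (V.F₀ X) (Dm.F₀ X (Free X))
    ρv-dinat : ∀ {X Y} (f : Hom X Y) →
               Dm.F₁ id (Σ⋆₁ f) ∘ ρv X ≡ Dm.F₁ f id ∘ ρv Y ∘ V.F₁ f
    ρc : ∀ X Y → Hom (K.F₀ (X ⊗ B₀ X Y) X) (T₀ (Free (X ⊕ Y)))
    ρc-dinat : ∀ {X X' Y} (f : Hom X X') →
               T₁ (Σ⋆₁ (f ⊕₁ id)) ∘ ρc X Y ∘ K.F₁ (id ⊗₁ B₁ f id) id
               ≡ ρc X' Y ∘ K.F₁ (f ⊗₁ id) f
    ρc-nat : ∀ {X Y Y'} (g : Hom Y Y') →
             T₁ (Σ⋆₁ (id ⊕₁ g)) ∘ ρc X Y ≡ ρc X Y' ∘ K.F₁ (id ⊗₁ B₁ id g) id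
    χ : ∀ X Y → Hom (K.F₀ (T₀ X) Y) (T₀ (K.F₀ X Y))
    χ-nat : ∀ {X X' Y Y'} (f : Hom X X') (g : Hom Y Y') →
            T₁ (K.F₁ f g) ∘ χ X Y ≡ χ X' Y' ∘ K.F₁ (T₁ f) g
    χ-unit : ∀ {X Y} → χ X Y ∘ K.F₁ ηT id ≡ ηT
    χ-mult : ∀ {X Y} → χ X Y ∘ K.F₁ mT id ≡ mT ∘ T₁ (χ X Y) ∘ χ (T₀ X) Y

module LawOps {o h r} {C : Category o h} {DC : Distributive C} {S : Signature C}
       {FA : FreeAlgebras DC S} {M : StrongMonad DC} {D : MixedBifunctor C}
       (P : KleisliCPO M r) (L : SeparatedLaw FA M D) where
  open Category C
  open Distributive DC
  open DistOps DC
  open SigOps DC S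
  open FreeAlgebras FA
  open FreeOps FA
  open StrongMonad M using (ηT; mT)
  open MonadOps M
  open BehOps M D
  open SeparatedLaw L
  open CPOOps P

  ChiContinuous : Set (o ⊔ h ⊔ r)
  ChiContinuous = ∀ {A X Y} → Continuous (λ (f : Hom A (T₀ X)) → χ X Y ∘ K.F₁ f id)

  ρcv : ∀ X Y → Hom (K.F₀ (X ⊗ T₀ (Dm.F₀ X Y)) X) (T₀ (Free (X ⊕ Y)))
  ρcv X Y = ρc X Y ∘ K.F₁ (id ⊗₁ inl) id

  γv : Hom Sv (T₀ (Dm.F₀ Init Init))
  γv = ηT ∘ Dm.F₁ id μ₀ ∘ ρv Init

  ξ : ∀ X → Hom (K.F₀ (V.F₀ X) X) (T₀ (Free X))
  ξ X = T₁ ∇♯ ∘ ρcv (Free X) (Free X)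
        ∘ K.F₁ ⟨ ιv , ηT ∘ Dm.F₁ id μΣ ∘ ρv (Free X) ⟩ id
        ∘ K.F₁ (V.F₁ η) η

  -- the functional defining ζ̂ = μ f. ζ̂-step f
  ζ̂-step : Hom Init (T₀ Sv) → Hom Init (T₀ Sv)
  ζ̂-step f = [ ηT , f ♯ ∘ T₁ μ₀ ∘ ξ Init ♯ ∘ χ Sv Init ∘ K.F₁ f id ] ∘ ι⁻¹

  rhs-step : Hom Init (T₀ Sv) → Hom Init (T₀ Sv)
  rhs-step f = [ ηT , f ♯ ∘ T₁ ∇♯ ∘ ρcv Init Init ♯ ∘ χ _ Init
                      ∘ K.F₁ (T₁ ⟨ ιv , γv ⟩ ∘ f) id ] ∘ ι⁻¹

  BigStepEquation : Set (h ⊔ r)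
  BigStepEquation = Σ (Hom Init (T₀ Sv)) λ z →
                      IsLeastFixpoint ζ̂-step z × IsLeastFixpoint rhs-step z

-- Both functionals are instances of  f ↦ [ η , f♯ ∘ H♯ ∘ χ ∘ Σc(f, id) ] ∘ ι⁻¹ :
-- trivially for H = T μ₀ ∘ ξ, and for H = T ∇♯ ∘ ρcv ∘ Σc(⟨ιv, γv⟩, id) by
-- naturality of χ and the Kleisli laws.  These two choices of H agree: flattening
-- with μ the term that ξ produces over Σ⋆μΣ can be pushed into ρc, through its
-- naturality in the second and dinaturality in the first argument, and into γ,
-- through dinaturality of ρv; what remains is ρcv run directly on μΣ.  Since T and
-- χ are ω-continuous, so is the common functional, and Kleene's theorem provides
-- its least fixpoint.
module Submission where

open import Defs
open import Level using (Level)
open import Data.Nat using (ℕ; zero; suc; _≤_; _≤′_; ≤′-refl; ≤′-step; _⊔_)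
open import Data.Nat.Properties using (≤⇒≤′; m≤m⊔n; m≤n⊔m)
open import Data.Product using (Σ; _,_; proj₁; proj₂)
open import Relation.Binary.PropositionalEquality
  using (_≡_; refl; sym; trans; cong; cong₂; subst; module ≡-Reasoning)

module HomReasoning {o h} (C : Category o h) where
  open Category C

  infixr 9 _⟩∘⟨_
  _⟩∘⟨_ : ∀ {A B E} {f f' : Hom B E} {g g' : Hom A B} →
          f ≡ f' → g ≡ g' → f ∘ g ≡ f' ∘ g'
  _⟩∘⟨_ = cong₂ _∘_

  pullˡ : ∀ {A B E F} {a : Hom E F} {b : Hom B E} {c : Hom B F} {f : Hom A B} →
          a ∘ b ≡ c → a ∘ b ∘ f ≡ c ∘ f
  pullˡ {f = f} eq = trans (sym assoc) (cong (_∘ f) eq)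

  pullʳ : ∀ {A B E F} {a : Hom E F} {b : Hom B E} {f : Hom A B} {g : Hom A E} →
          b ∘ f ≡ g → (a ∘ b) ∘ f ≡ a ∘ g
  pullʳ eq = trans assoc (refl ⟩∘⟨ eq)

  cancelʳ : ∀ {A B E} {a : Hom B E} {b : Hom A B} {f : Hom B A} →
            b ∘ f ≡ id → (a ∘ b) ∘ f ≡ a
  cancelʳ eq = trans (pullʳ eq) identityʳ

  pull₃ : ∀ {A B E F G} {a : Hom F G} {b : Hom E F} {c : Hom B E} {d : Hom B G}
            {f : Hom A B} →
          a ∘ b ∘ c ≡ d → a ∘ b ∘ c ∘ f ≡ d ∘ f
  pull₃ eq = trans (refl ⟩∘⟨ sym assoc) (pullˡ eq)

module BifunctorLaws {o h} {C : Category o h} (F : Bifunctor C) where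
  open Category C
  open Bifunctor F

  F₁-square : ∀ {A A' A'' A₁ B B' B'' B₁}
                {f : Hom A' A''} {f' : Hom A A'} {k : Hom A₁ A''} {k' : Hom A A₁}
                {g : Hom B' B''} {g' : Hom B B'} {l : Hom B₁ B''} {l' : Hom B B₁} →
              f ∘ f' ≡ k ∘ k' → g ∘ g' ≡ l ∘ l' →
              F₁ f g ∘ F₁ f' g' ≡ F₁ k l ∘ F₁ k' l'
  F₁-square p q = trans (sym F-∘) (trans (cong₂ F₁ p q) F-∘)

module MixedBifunctorLaws {o h} {C : Category o h} (F : MixedBifunctor C) where
  open Category C
  open MixedBifunctor F

  F₁-square : ∀ {A A' A'' A₁ B B' B'' B₁}
                {f : Hom A'' A'} {f' : Hom A' A} {k : Hom A'' A₁} {k' : Hom A₁ A}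
                {g : Hom B' B''} {g' : Hom B B'} {l : Hom B₁ B''} {l' : Hom B B₁} →
              f' ∘ f ≡ k' ∘ k → g ∘ g' ≡ l ∘ l' →
              F₁ f g ∘ F₁ f' g' ≡ F₁ k l ∘ F₁ k' l'
  F₁-square p q = trans (sym F-∘) (trans (cong₂ F₁ p q) F-∘)

  F₁-interchange : ∀ {A A' B B'} {f : Hom A' A} {g : Hom B B'} →
                   F₁ id g ∘ F₁ f id ≡ F₁ f id ∘ F₁ id g
  F₁-interchange =
    F₁-square (trans identityʳ (sym identityˡ)) (trans identityʳ (sym identityˡ))

module CoproductLaws {o h} {C : Category o h} (DC : Distributive C) where
  open Category C
  open Distributive DC
  open DistOps DC
  open HomReasoning C

  ∘-[] : ∀ {A B X Y} {f : Hom A X} {g : Hom B X} (k : Hom X Y) →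
         k ∘ [ f , g ] ≡ [ k ∘ f , k ∘ g ]
  ∘-[] k = []-unique (pullʳ []-inl) (pullʳ []-inr)

  []∘⊕₁ : ∀ {A B A' B' X} {f : Hom A' X} {g : Hom B' X} {a : Hom A A'} {b : Hom B B'} →
          [ f , g ] ∘ (a ⊕₁ b) ≡ [ f ∘ a , g ∘ b ]
  []∘⊕₁ = trans (∘-[] _) (cong₂ [_,_] (pullˡ []-inl) (pullˡ []-inr))

  ⊕₁-∘ : ∀ {A B A' B' A'' B''} {f : Hom A A'} {f' : Hom B B'}
           {g : Hom A' A''} {g' : Hom B' B''} →
         (g ⊕₁ g') ∘ (f ⊕₁ f') ≡ (g ∘ f) ⊕₁ (g' ∘ f')
  ⊕₁-∘ = trans []∘⊕₁ (cong₂ [_,_] assoc assoc)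

  ∇-natural : ∀ {A B} {k : Hom A B} → k ∘ ∇ ≡ ∇ ∘ (k ⊕₁ k)
  ∇-natural {k = k} = trans (∘-[] k) (trans (cong₂ [_,_] k∘id≡id∘k k∘id≡id∘k) (sym []∘⊕₁))
    where
    k∘id≡id∘k : k ∘ id ≡ id ∘ k
    k∘id≡id∘k = trans identityʳ (sym identityˡ)

  ⟨⟩∘ : ∀ {X Y A B} {a : Hom Y A} {b : Hom Y B} {k : Hom X Y} →
        ⟨ a , b ⟩ ∘ k ≡ ⟨ a ∘ k , b ∘ k ⟩
  ⟨⟩∘ = ⟨⟩-unique (pullˡ fst-⟨⟩) (pullˡ snd-⟨⟩)

  ⊗₁∘⟨⟩ : ∀ {X A B A' B'} {f : Hom A A'} {g : Hom B B'} {a : Hom X A} {b : Hom X B} →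
          (f ⊗₁ g) ∘ ⟨ a , b ⟩ ≡ ⟨ f ∘ a , g ∘ b ⟩
  ⊗₁∘⟨⟩ = trans ⟨⟩∘ (cong₂ ⟨_,_⟩ (pullʳ fst-⟨⟩) (pullʳ snd-⟨⟩))

module FreeMonadLaws {o h} {C : Category o h} {DC : Distributive C} {S : Signature C}
       (FA : FreeAlgebras DC S) where
  open Category C
  open Distributive DC
  open DistOps DC
  open SigOps DC S
  open FreeAlgebras FA
  open FreeOps FA
  open HomReasoning C
  open CoproductLaws DC
  open ≡-Reasoning

  Σ₁-∘ : ∀ {A B E} {f : Hom A B} {g : Hom B E} → Σ₁ (g ∘ f) ≡ Σ₁ g ∘ Σ₁ f
  Σ₁-∘ = trans (cong₂ _⊕₁_ V.F-∘ K.F-∘) (sym ⊕₁-∘)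

  fold-fusion : ∀ {X A B} {a : Hom (Σ₀ A) A} {b : Hom (Σ₀ B) B} {f : Hom X A}
                (k : Hom A B) → k ∘ a ≡ b ∘ Σ₁ k → k ∘ fold a f ≡ fold b (k ∘ f)
  fold-fusion {a = a} {b} {f} k hom = fold-unique
    (begin
      (k ∘ fold a f) ∘ ι          ≡⟨ pullʳ fold-ι ⟩
      k ∘ a ∘ Σ₁ (fold a f)       ≡⟨ pullˡ hom ⟩
      (b ∘ Σ₁ k) ∘ Σ₁ (fold a f)  ≡⟨ pullʳ (sym Σ₁-∘) ⟩
      b ∘ Σ₁ (k ∘ fold a f)       ∎)
    (pullʳ fold-η)

  fold-ι-∘ : ∀ {X Y Z} {g : Hom Y (Free Z)} {f : Hom X (Free Y)} →
             fold ι g ∘ fold ι f ≡ fold ι (fold ι g ∘ f)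
  fold-ι-∘ {g = g} = fold-fusion (fold ι g) fold-ι

  fold-ι-∘-Σ⋆₁ : ∀ {X Y Z} {g : Hom Y (Free Z)} {f : Hom X Y} →
                 fold ι g ∘ Σ⋆₁ f ≡ fold ι (g ∘ f)
  fold-ι-∘-Σ⋆₁ = trans fold-ι-∘ (cong (fold ι) (pullˡ fold-η))

  Σ⋆₁-∘ : ∀ {X Y Z} {g : Hom Y Z} {f : Hom X Y} → Σ⋆₁ g ∘ Σ⋆₁ f ≡ Σ⋆₁ (g ∘ f)
  Σ⋆₁-∘ = trans fold-ι-∘-Σ⋆₁ (cong (fold ι) assoc)

  μΣ-assoc : ∀ {X} → μΣ {X} ∘ μΣ ≡ μΣ ∘ Σ⋆₁ μΣ
  μΣ-assoc = trans fold-ι-∘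
    (trans (cong (fold ι) (trans identityʳ (sym identityˡ))) (sym fold-ι-∘-Σ⋆₁))

  V-μΣ∘η : ∀ {X} → V.F₁ (μΣ {X}) ∘ V.F₁ η ≡ id
  V-μΣ∘η = trans (sym V.F-∘) (trans (cong V.F₁ fold-η) V.F-id)

  μΣ∘ιv : ∀ {X} → μΣ {X} ∘ ιv ∘ V.F₁ η ≡ ιv
  μΣ∘ιv = begin
    μΣ ∘ (ι ∘ inl) ∘ V.F₁ η        ≡⟨ refl ⟩∘⟨ assoc ⟩
    μΣ ∘ ι ∘ inl ∘ V.F₁ η          ≡⟨ pullˡ fold-ι ⟩
    (ι ∘ Σ₁ μΣ) ∘ inl ∘ V.F₁ η     ≡⟨ pullʳ (pullˡ []-inl) ⟩
    ι ∘ (inl ∘ V.F₁ μΣ) ∘ V.F₁ η   ≡⟨ refl ⟩∘⟨ cancelʳ V-μΣ∘η ⟩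
    ι ∘ inl                        ∎

  μΣ∘∇♯ : ∀ {X} → μΣ {X} ∘ ∇♯ ≡ ∇♯ ∘ Σ⋆₁ (μΣ ⊕₁ id) ∘ Σ⋆₁ (id ⊕₁ μΣ)
  μΣ∘∇♯ = begin
    μΣ ∘ μΣ ∘ Σ⋆₁ ∇
      ≡⟨ pullˡ μΣ-assoc ⟩
    (μΣ ∘ Σ⋆₁ μΣ) ∘ Σ⋆₁ ∇
      ≡⟨ pullʳ Σ⋆₁-∘ ⟩
    μΣ ∘ Σ⋆₁ (μΣ ∘ ∇)
      ≡⟨ refl ⟩∘⟨ cong Σ⋆₁ (trans ∇-natural (refl ⟩∘⟨ split)) ⟩
    μΣ ∘ Σ⋆₁ (∇ ∘ (μΣ ⊕₁ id) ∘ (id ⊕₁ μΣ))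
      ≡⟨ refl ⟩∘⟨ sym (trans (refl ⟩∘⟨ Σ⋆₁-∘) Σ⋆₁-∘) ⟩
    μΣ ∘ Σ⋆₁ ∇ ∘ Σ⋆₁ (μΣ ⊕₁ id) ∘ Σ⋆₁ (id ⊕₁ μΣ)
      ≡⟨ sym assoc ⟩
    ∇♯ ∘ Σ⋆₁ (μΣ ⊕₁ id) ∘ Σ⋆₁ (id ⊕₁ μΣ)
      ∎
    where
    split : μΣ ⊕₁ μΣ ≡ (μΣ ⊕₁ id) ∘ (id ⊕₁ μΣ)
    split = sym (trans ⊕₁-∘ (cong₂ _⊕₁_ identityʳ identityˡ))

module KleisliLaws {o h} {C : Category o h} {DC : Distributive C} (M : StrongMonad DC) where
  open Category C
  open StrongMonad M
  open MonadOps M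
  open HomReasoning C
  open ≡-Reasoning

  T₁∘♯ : ∀ {X Y Z} {a : Hom Y Z} {b : Hom X (T₀ Y)} → T₁ a ∘ b ♯ ≡ (T₁ a ∘ b) ♯
  T₁∘♯ {a = a} {b} = begin
    T₁ a ∘ mT ∘ T₁ b         ≡⟨ pullˡ mT-nat ⟩
    (mT ∘ T₁ (T₁ a)) ∘ T₁ b  ≡⟨ pullʳ (sym F-∘) ⟩
    mT ∘ T₁ (T₁ a ∘ b)       ∎

  ♯∘T₁ : ∀ {X X' Y} {b : Hom X (T₀ Y)} {c : Hom X' X} → b ♯ ∘ T₁ c ≡ (b ∘ c) ♯
  ♯∘T₁ = pullʳ (sym F-∘)

  ♯∘ηT : ∀ {X Y} {g : Hom X (T₀ Y)} → g ♯ ∘ ηT ≡ g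
  ♯∘ηT {g = g} = begin
    (mT ∘ T₁ g) ∘ ηT  ≡⟨ pullʳ ηT-nat ⟩
    mT ∘ ηT ∘ g       ≡⟨ pullˡ unitˡ ⟩
    id ∘ g            ≡⟨ identityˡ ⟩
    g                 ∎

module KleisliCPOLaws {o h r} {C : Category o h} {DC : Distributive C} {M : StrongMonad DC}
       (P : KleisliCPO M r) where
  open Category C
  open MonadOps M
  open KleisliCPO P
  open CPOOps P

  ≡⇒⊑ : ∀ {X Y} {f g : Hom X (T₀ Y)} → f ≡ g → f ⊑ g
  ≡⇒⊑ {f = f} e = subst (f ⊑_) e ⊑-refl

  ⨆-cong : ∀ {X Y} {c d : ℕ → Hom X (T₀ Y)} {ch : Chain c} {dh : Chain d} →
           (∀ n → c n ≡ d n) → ⨆ c ch ≡ ⨆ d dh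
  ⨆-cong {c = c} {d} {ch} {dh} e = ⊑-antisym
    (⨆-least c ch (λ n → ⊑-trans (≡⇒⊑ (e n)) (⨆-upper d dh n)))
    (⨆-least d dh (λ n → ⊑-trans (≡⇒⊑ (sym (e n))) (⨆-upper c ch n)))

  ⨆-const : ∀ {X Y} (x : Hom X (T₀ Y)) → x ≡ ⨆ (λ _ → x) (λ _ → ⊑-refl)
  ⨆-const x = ⊑-antisym (⨆-upper _ _ 0) (⨆-least _ _ (λ _ → ⊑-refl))

  chain-mono : ∀ {X Y} {c : ℕ → Hom X (T₀ Y)} → Chain c → ∀ {m n} → m ≤ n → c m ⊑ c n
  chain-mono {c = c} ch m≤n = go (≤⇒≤′ m≤n)
    where
    go : ∀ {m n} → m ≤′ n → c m ⊑ c n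
    go ≤′-refl      = ⊑-refl
    go (≤′-step m≤n) = ⊑-trans (go m≤n) (ch _)

  ∘-continuous : ∀ {X Y X' Y' X'' Y''} {F : Hom X' (T₀ Y') → Hom X'' (T₀ Y'')}
                   {G : Hom X (T₀ Y) → Hom X' (T₀ Y')} →
                 Continuous F → Continuous G → Continuous (λ f → F (G f))
  ∘-continuous {F = F} cF cG = record
    { mono = λ p → Continuous.mono cF (Continuous.mono cG p)
    ; sup  = λ c ch → trans (cong F (Continuous.sup cG c ch)) (Continuous.sup cF _ _)
    }

  continuous-resp : ∀ {X Y X' Y'} {F G : Hom X (T₀ Y) → Hom X' (T₀ Y')} →
                    (∀ f → F f ≡ G f) → Continuous F → Continuous G
  continuous-resp e cF = record
    { mono = λ {f} {g} p →
        ⊑-trans (≡⇒⊑ (sym (e f))) (⊑-trans (Continuous.mono cF p) (≡⇒⊑ (e g)))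
    ; sup  = λ c ch →
        trans (sym (e _)) (trans (Continuous.sup cF c ch) (⨆-cong (λ n → e (c n))))
    }

  kleene : ∀ {X Y} {F : Hom X (T₀ Y) → Hom X (T₀ Y)} → Continuous F →
           Σ (Hom X (T₀ Y)) (IsLeastFixpoint F)
  kleene {X} {Y} {F} cF = ⨆ c ch , fixed , least
    where
    c : ℕ → Hom X (T₀ Y)
    c zero    = ⊥
    c (suc n) = F (c n)
    ch : Chain c
    ch zero    = ⊥-least
    ch (suc n) = Continuous.mono cF (ch n)
    fixed : F (⨆ c ch) ≡ ⨆ c ch
    fixed = trans (Continuous.sup cF c ch) (⊑-antisym
      (⨆-least _ _ (λ n → ⨆-upper c ch (suc n)))
      (⨆-least c ch (λ n → ⊑-trans (ch n) (⨆-upper _ _ n))))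
    below : ∀ w → F w ≡ w → ∀ n → c n ⊑ w
    below w e zero    = ⊥-least
    below w e (suc n) = ⊑-trans (Continuous.mono cF (below w e n)) (≡⇒⊑ e)
    least : ∀ w → F w ≡ w → ⨆ c ch ⊑ w
    least w e = ⨆-least c ch (below w e)

  isLeastFixpoint-resp : ∀ {X Y} {F G : Hom X (T₀ Y) → Hom X (T₀ Y)} {z} →
                         (∀ f → G f ≡ F f) → IsLeastFixpoint F z → IsLeastFixpoint G z
  isLeastFixpoint-resp {z = z} e (Fz≡z , leastF) =
    trans (e z) Fz≡z , λ w Gw≡w → leastF w (trans (sym (e w)) Gw≡w)

module OmegaContinuousLaws {o h r} {C : Category o h} {DC : Distributive C}
       {M : StrongMonad DC} {P : KleisliCPO M r} (OC : OmegaContinuous P) where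
  open Category C
  open Distributive DC
  open StrongMonad M using (ηT)
  open MonadOps M
  open KleisliCPO P
  open CPOOps P
  open OmegaContinuous OC
  open HomReasoning C
  open KleisliLaws M
  open KleisliCPOLaws P

  precompose-continuous : ∀ {X X' Y} (k : Hom X X') →
                          Continuous (λ (g : Hom X' (T₀ Y)) → g ∘ k)
  precompose-continuous k =
    continuous-resp (λ g → pullˡ ♯∘ηT) (kleisli-contˡ (ηT ∘ k))

  copair-continuous : ∀ {A B Y X' Y'} (u : Hom A (T₀ Y))
                        {F : Hom X' (T₀ Y') → Hom B (T₀ Y)} →
                      Continuous F → Continuous (λ f → [ u , F f ])
  copair-continuous u cF = record
    { mono = λ p → copair-mono ⊑-refl (Continuous.mono cF p)
    ; sup  = λ c ch → trans (cong₂ [_,_] (⨆-const u) (Continuous.sup cF c ch))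
                            (copair-sup _ _ _ _)
    }

  ♯-diagonal-continuous : ∀ {W Y Z} {G : Hom Y (T₀ Z) → Hom W (T₀ Y)} → Continuous G →
                          Continuous (λ f → f ♯ ∘ G f)
  ♯-diagonal-continuous {W = W} {Z = Z} {G = G} cG =
    record { mono = λ p → mono₂ p (monoG p) ; sup = sup }
    where
    monoG : ∀ {f f'} → f ⊑ f' → G f ⊑ G f'
    monoG = Continuous.mono cG

    mono₂ : ∀ {f f' x x'} → f ⊑ f' → x ⊑ x' → (f ♯ ∘ x) ⊑ (f' ♯ ∘ x')
    mono₂ {f' = f'} {x = x} p q =
      ⊑-trans (Continuous.mono (kleisli-contˡ x) p) (Continuous.mono (kleisli-contʳ f') q)

    sup : ∀ c (ch : Chain c) →
          ⨆ c ch ♯ ∘ G (⨆ c ch) ≡ ⨆ (λ n → c n ♯ ∘ G (c n)) (λ n → mono₂ (ch n) (monoG (ch n)))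
    sup c ch = ⊑-antisym
      (⊑-trans (≡⇒⊑ (trans (refl ⟩∘⟨ Continuous.sup cG c ch)
                           (Continuous.sup (kleisli-contʳ (⨆ c ch)) _ _)))
               (⨆-least _ _ column))
      (⨆-least _ _ λ n → mono₂ (⨆-upper c ch n) (monoG (⨆-upper c ch n)))
      where
      diagonal : Hom W (T₀ Z)
      diagonal = ⨆ (λ n → c n ♯ ∘ G (c n)) (λ n → mono₂ (ch n) (monoG (ch n)))

      below-diagonal : ∀ m n → (c m ♯ ∘ G (c n)) ⊑ diagonal
      below-diagonal m n = ⊑-trans
        (mono₂ (chain-mono ch (m≤m⊔n m n)) (monoG (chain-mono ch (m≤n⊔m m n))))
        (⨆-upper _ _ (m ⊔ n))

      column : ∀ n → (⨆ c ch ♯ ∘ G (c n)) ⊑ diagonal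
      column n = ⊑-trans (≡⇒⊑ (Continuous.sup (kleisli-contˡ (G (c n))) c ch))
                         (⨆-least _ _ λ m → below-diagonal m n)

module BigStep {o h r} {C : Category o h} {DC : Distributive C} {S : Signature C}
       {FA : FreeAlgebras DC S} {M : StrongMonad DC} {D : MixedBifunctor C}
       (P : KleisliCPO M r) (L : SeparatedLaw FA M D) where
  open Category C
  open Distributive DC
  open DistOps DC
  open SigOps DC S
  open Signature S using (Σc)
  open FreeAlgebras FA
  open FreeOps FA
  open StrongMonad M using (ηT; ηT-nat)
  open MonadOps M
  open BehOps M D
  open SeparatedLaw L
  open LawOps P L
  open HomReasoning C
  open CoproductLaws DC
  open FreeMonadLaws FA
  open KleisliLaws M
  open BifunctorLaws Σc using () renaming (F₁-square to K-square)
  open MixedBifunctorLaws D using ()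
    renaming (F₁-square to D-square; F₁-interchange to D-interchange)
  open ≡-Reasoning

  γ : ∀ X → Hom (V.F₀ (Free X)) (T₀ (Dm.F₀ (Free X) (Free X)))
  γ X = ηT ∘ Dm.F₁ id μΣ ∘ ρv (Free X)

  ρv-μΣ : ∀ {X} → Dm.F₁ id μΣ ∘ (Dm.F₁ id μΣ ∘ ρv (Free (Free X))) ∘ V.F₁ η
                  ≡ Dm.F₁ μΣ id ∘ Dm.F₁ id (μΣ {X}) ∘ ρv (Free X)
  ρv-μΣ = begin
    Dm.F₁ id μΣ ∘ (Dm.F₁ id μΣ ∘ ρv _) ∘ V.F₁ η
      ≡⟨ refl ⟩∘⟨ assoc ⟩
    Dm.F₁ id μΣ ∘ Dm.F₁ id μΣ ∘ ρv _ ∘ V.F₁ η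
      ≡⟨ pullˡ (D-square refl μΣ-assoc) ⟩
    (Dm.F₁ id μΣ ∘ Dm.F₁ id (Σ⋆₁ μΣ)) ∘ ρv _ ∘ V.F₁ η
      ≡⟨ pullʳ (pullˡ (ρv-dinat μΣ)) ⟩
    Dm.F₁ id μΣ ∘ (Dm.F₁ μΣ id ∘ ρv _ ∘ V.F₁ μΣ) ∘ V.F₁ η
      ≡⟨ refl ⟩∘⟨ pullʳ (cancelʳ V-μΣ∘η) ⟩
    Dm.F₁ id μΣ ∘ Dm.F₁ μΣ id ∘ ρv _
      ≡⟨ trans (pullˡ D-interchange) assoc ⟩
    Dm.F₁ μΣ id ∘ Dm.F₁ id μΣ ∘ ρv _
      ∎

  γ-dinatural : ∀ {X} →
    T₁ (Dm.F₁ id μΣ) ∘ γ (Free X) ∘ V.F₁ η ≡ T₁ (Dm.F₁ (μΣ {X}) id) ∘ γ X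
  γ-dinatural = begin
    T₁ (Dm.F₁ id μΣ) ∘ (ηT ∘ Dm.F₁ id μΣ ∘ ρv _) ∘ V.F₁ η
      ≡⟨ refl ⟩∘⟨ assoc ⟩
    T₁ (Dm.F₁ id μΣ) ∘ ηT ∘ (Dm.F₁ id μΣ ∘ ρv _) ∘ V.F₁ η
      ≡⟨ pullˡ ηT-nat ⟩
    (ηT ∘ Dm.F₁ id μΣ) ∘ (Dm.F₁ id μΣ ∘ ρv _) ∘ V.F₁ η
      ≡⟨ pullʳ ρv-μΣ ⟩
    ηT ∘ Dm.F₁ μΣ id ∘ Dm.F₁ id μΣ ∘ ρv _
      ≡⟨ trans (pullˡ (sym ηT-nat)) assoc ⟩
    T₁ (Dm.F₁ μΣ id) ∘ γ _
      ∎

  B₁∘inl : ∀ {X A A' E E'} {f : Hom A' A} {g : Hom E E'} {x : Hom X (T₀ (Dm.F₀ A E))} →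
           B₁ f g ∘ inl ∘ x ≡ inl ∘ T₁ (Dm.F₁ f g) ∘ x
  B₁∘inl = trans (pullˡ []-inl) assoc

  argument-μΣ-output : ∀ {X} →
    (id ⊗₁ B₁ id μΣ) ∘ (id ⊗₁ inl) ∘ ⟨ ιv , γ (Free X) ⟩ ∘ V.F₁ η
    ≡ (id ⊗₁ B₁ (μΣ {X}) id) ∘ ⟨ ιv ∘ V.F₁ η , inl ∘ γ X ⟩
  argument-μΣ-output = begin
    (id ⊗₁ B₁ id μΣ) ∘ (id ⊗₁ inl) ∘ ⟨ ιv , γ _ ⟩ ∘ V.F₁ η
      ≡⟨ refl ⟩∘⟨ refl ⟩∘⟨ ⟨⟩∘ ⟩
    (id ⊗₁ B₁ id μΣ) ∘ (id ⊗₁ inl) ∘ ⟨ ιv ∘ V.F₁ η , γ _ ∘ V.F₁ η ⟩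
      ≡⟨ refl ⟩∘⟨ ⊗₁∘⟨⟩ ⟩
    (id ⊗₁ B₁ id μΣ) ∘ ⟨ id ∘ ιv ∘ V.F₁ η , inl ∘ γ _ ∘ V.F₁ η ⟩
      ≡⟨ ⊗₁∘⟨⟩ ⟩
    ⟨ id ∘ id ∘ ιv ∘ V.F₁ η , B₁ id μΣ ∘ inl ∘ γ _ ∘ V.F₁ η ⟩
      ≡⟨ cong₂ ⟨_,_⟩ identityˡ (trans B₁∘inl (trans (refl ⟩∘⟨ γ-dinatural) (sym B₁∘inl))) ⟩
    ⟨ id ∘ ιv ∘ V.F₁ η , B₁ μΣ id ∘ inl ∘ γ _ ⟩
      ≡⟨ sym ⊗₁∘⟨⟩ ⟩
    (id ⊗₁ B₁ μΣ id) ∘ ⟨ ιv ∘ V.F₁ η , inl ∘ γ _ ⟩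
      ∎

  argument-μΣ-input : ∀ {X} →
    (μΣ ⊗₁ id) ∘ ⟨ ιv ∘ V.F₁ η , inl {B = T₀ (Free X)} ∘ γ X ⟩
    ≡ (id ⊗₁ inl {B = T₀ (Free X)}) ∘ ⟨ ιv , γ X ⟩
  argument-μΣ-input =
    trans ⊗₁∘⟨⟩ (trans (cong₂ ⟨_,_⟩ (trans μΣ∘ιv (sym identityˡ)) identityˡ) (sym ⊗₁∘⟨⟩))

  T₁μΣ∘ξ : ∀ X → T₁ μΣ ∘ ξ (Free X) ≡ T₁ ∇♯ ∘ ρcv (Free X) (Free X) ∘ K.F₁ ⟨ ιv , γ X ⟩ id
  T₁μΣ∘ξ X = begin
    T₁ μΣ ∘ T₁ ∇♯ ∘ (ρc _ _ ∘ K.F₁ (id ⊗₁ inl) id) ∘ K.F₁ ⟨ ιv , γ _ ⟩ id ∘ K.F₁ (V.F₁ η) η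
      ≡⟨ refl ⟩∘⟨ refl ⟩∘⟨ pullʳ merge ⟩
    T₁ μΣ ∘ T₁ ∇♯ ∘ ρc _ _ ∘ K.F₁ ((id ⊗₁ inl) ∘ ⟨ ιv , γ _ ⟩ ∘ V.F₁ η) η
      ≡⟨ pullˡ (trans (sym F-∘) (trans (cong T₁ μΣ∘∇♯) (trans F-∘ (refl ⟩∘⟨ F-∘)))) ⟩
    (T₁ ∇♯ ∘ T₁ (Σ⋆₁ (μΣ ⊕₁ id)) ∘ T₁ (Σ⋆₁ (id ⊕₁ μΣ))) ∘ ρc _ _ ∘ K.F₁ _ η
      ≡⟨ pullʳ (pullʳ (pullˡ (ρc-nat μΣ))) ⟩
    T₁ ∇♯ ∘ T₁ (Σ⋆₁ (μΣ ⊕₁ id)) ∘ (ρc _ _ ∘ K.F₁ (id ⊗₁ B₁ id μΣ) id) ∘ K.F₁ _ η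
      ≡⟨ refl ⟩∘⟨ refl ⟩∘⟨ pullʳ (K-square argument-μΣ-output refl) ⟩
    T₁ ∇♯ ∘ T₁ (Σ⋆₁ (μΣ ⊕₁ id)) ∘ ρc _ _ ∘ K.F₁ (id ⊗₁ B₁ μΣ id) id
                                         ∘ K.F₁ ⟨ ιv ∘ V.F₁ η , inl ∘ γ _ ⟩ η
      ≡⟨ refl ⟩∘⟨ pull₃ (ρc-dinat μΣ) ⟩
    T₁ ∇♯ ∘ (ρc _ _ ∘ K.F₁ (μΣ ⊗₁ id) μΣ) ∘ K.F₁ ⟨ ιv ∘ V.F₁ η , inl ∘ γ _ ⟩ η
      ≡⟨ refl ⟩∘⟨ pullʳ (K-square argument-μΣ-input (trans fold-η (sym identityˡ))) ⟩
    T₁ ∇♯ ∘ ρc _ _ ∘ K.F₁ (id ⊗₁ inl) id ∘ K.F₁ ⟨ ιv , γ _ ⟩ id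
      ≡⟨ refl ⟩∘⟨ sym assoc ⟩
    T₁ ∇♯ ∘ ρcv _ _ ∘ K.F₁ ⟨ ιv , γ _ ⟩ id
      ∎
    where
    merge : K.F₁ (id ⊗₁ inl) id ∘ K.F₁ ⟨ ιv , γ (Free X) ⟩ id ∘ K.F₁ (V.F₁ η) η
            ≡ K.F₁ ((id ⊗₁ inl) ∘ ⟨ ιv , γ (Free X) ⟩ ∘ V.F₁ η) η
    merge = trans (refl ⟩∘⟨ sym K.F-∘)
                  (trans (sym K.F-∘) (cong (K.F₁ _) (trans identityˡ identityˡ)))

  step : Hom (K.F₀ Sv Init) (T₀ Init) → Hom Init (T₀ Sv) → Hom Init (T₀ Sv)
  step H f = [ ηT , f ♯ ∘ H ♯ ∘ χ Sv Init ∘ K.F₁ f id ] ∘ ι⁻¹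

  ζ̂-step≡step : ∀ f → ζ̂-step f ≡ step (T₁ μ₀ ∘ ξ Init) f
  ζ̂-step≡step f = cong (λ k → [ ηT , f ♯ ∘ k ] ∘ ι⁻¹) (pullˡ T₁∘♯)

  rhs-step≡step : ∀ f → rhs-step f ≡ step (T₁ μ₀ ∘ ξ Init) f
  rhs-step≡step f = cong (λ k → [ ηT , f ♯ ∘ k ] ∘ ι⁻¹) (begin
    T₁ ∇♯ ∘ ρcv _ _ ♯ ∘ χ _ Init ∘ K.F₁ (T₁ g ∘ f) id
      ≡⟨ refl ⟩∘⟨ refl ⟩∘⟨ refl ⟩∘⟨ trans (cong (K.F₁ _) (sym identityˡ)) K.F-∘ ⟩
    T₁ ∇♯ ∘ ρcv _ _ ♯ ∘ χ _ Init ∘ K.F₁ (T₁ g) id ∘ K.F₁ f id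
      ≡⟨ refl ⟩∘⟨ refl ⟩∘⟨ trans (pullˡ (sym (χ-nat g id))) assoc ⟩
    T₁ ∇♯ ∘ ρcv _ _ ♯ ∘ T₁ (K.F₁ g id) ∘ χ Sv Init ∘ K.F₁ f id
      ≡⟨ refl ⟩∘⟨ pullˡ ♯∘T₁ ⟩
    T₁ ∇♯ ∘ (ρcv _ _ ∘ K.F₁ g id) ♯ ∘ χ Sv Init ∘ K.F₁ f id
      ≡⟨ pullˡ T₁∘♯ ⟩
    (T₁ ∇♯ ∘ ρcv _ _ ∘ K.F₁ g id) ♯ ∘ χ Sv Init ∘ K.F₁ f id
      ≡⟨ cong (λ H → H ♯ ∘ χ Sv Init ∘ K.F₁ f id) (sym (T₁μΣ∘ξ _)) ⟩
    (T₁ μ₀ ∘ ξ Init) ♯ ∘ χ Sv Init ∘ K.F₁ f id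
      ∎)
    where
    g : Hom Sv (Init ⊗ T₀ (Dm.F₀ Init Init))
    g = ⟨ ιv , γv ⟩

  module _ (OC : OmegaContinuous P) (χ-continuous : ChiContinuous) where
    open OmegaContinuous OC
    open CPOOps P using (Continuous; IsLeastFixpoint)
    open KleisliCPOLaws P
    open OmegaContinuousLaws OC

    step-continuous : ∀ H → Continuous (step H)
    step-continuous H =
      ∘-continuous (precompose-continuous ι⁻¹)
        (copair-continuous ηT
          (♯-diagonal-continuous (∘-continuous (kleisli-contʳ H) χ-continuous)))

    bigStepEquation : BigStepEquation
    bigStepEquation = proj₁ lfp
                    , isLeastFixpoint-resp {F = step H} ζ̂-step≡step (proj₂ lfp)
                    , isLeastFixpoint-resp {F = step H} rhs-step≡step (proj₂ lfp)
      where
      H : Hom (K.F₀ Sv Init) (T₀ Init)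
      H = T₁ μ₀ ∘ ξ Init
      lfp : Σ (Hom Init (T₀ Sv)) (IsLeastFixpoint (step H))
      lfp = kleene (step-continuous H)

proposition5p3 : ∀ {o h r : Level} {C : Category o h} {DC : Distributive C}
                   {S : Signature C} (FA : FreeAlgebras DC S) (M : StrongMonad DC)
                   (P : KleisliCPO M r) → OmegaContinuous P →
                   (D : MixedBifunctor C) (L : SeparatedLaw FA M D) →
                   LawOps.ChiContinuous P L →
                   LawOps.BigStepEquation P L
proposition5p3 FA M P OC D L χ-continuous = BigStep.bigStepEquation P L OC χ-continuous
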